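{- For a word $\sigma=\sigma_1\cdots\sigma_n$ over $\{1,\dots,k\}$, say $\sigma$ avoids $12\text{ - }3$ if there are no indices $i,j$ with $j>i+1$ and $\sigma_i<\sigma_{i+1}<\sigma_j$, and $\sigma$ avoids $21\text{ - }3$ if there are no indices $i,j$ with $j>i+1$ and $\sigma_{i+1}<\sigma_i<\sigma_j$. Let $[k]^n(\tau)$ be the set of words of length $n$ over $\{1,\dots,k\}$ avoiding $\tau$, and $F_\tau(x;k)=\sum_{n\ge0}|[k]^n(\tau)|x^n$. Then the patterns $12\text{ - }3$ and $21\text{ - }3$ are Wilf-equivalent (i.e. $|[k]^n(12\text{ - }3)|=|[k]^n(21\text{ - }3)|$ for all $k,n$), and for all $k\ge1$, \[ F_{12\text{ - }3}(x;k)=F_{21\text{ - }3}(x;k)=\prod_{j=0}^{k-1}\frac{1}{1-\frac{x}{(1-x)^j}}. \]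
   Context: The empty word (length $0$) is counted once. -}

module Defs where

open import Data.Nat as ℕ using (ℕ; zero; suc; _+_; _*_; _∸_)
open import Data.Fin as Fin using (Fin; toℕ)
open import Data.Fin.Properties using (any?)
import Data.Fin.Properties as FinP
import Data.Nat.Properties as ℕP
open import Data.Vec using (Vec; []; _∷_; lookup)
open import Data.List using (List; []; _∷_; map; concatMap; filter; length; upTo; allFin; foldr)
open import Data.Nat.ListAction using (sum)
open import Data.Product using (Σ; ∃; _×_; _,_)
open import Data.Product.Properties using ()
open import Relation.Nullary using (¬_; Dec; yes; no)
open import Relation.Nullary.Decidable using (_×-dec_; ¬?)
open import Relation.Binary.PropositionalEquality using (_≡_)

-- Words of length n over the alphabet {1,…,k}, encoded as Fin k
-- (letter a ∈ Fin k stands for toℕ a + 1; the order is that of Fin).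

Word : ℕ → ℕ → Set
Word k n = Vec (Fin k) n

allWords : (k n : ℕ) → List (Word k n)
allWords k zero    = [] ∷ []
allWords k (suc n) = concatMap (λ a → map (a ∷_) (allWords k n)) (allFin k)

Contains12-3 : ∀ {k n} → Word k n → Set
Contains12-3 {k} {n} σ =
  ∃ λ (i : Fin n) → ∃ λ (i' : Fin n) → ∃ λ (j : Fin n) →
    (toℕ i' ≡ suc (toℕ i)) × (toℕ i' ℕ.< toℕ j) ×
    (lookup σ i Fin.< lookup σ i') × (lookup σ i' Fin.< lookup σ j)

Contains21-3 : ∀ {k n} → Word k n → Set
Contains21-3 {k} {n} σ =
  ∃ λ (i : Fin n) → ∃ λ (i' : Fin n) → ∃ λ (j : Fin n) →
    (toℕ i' ≡ suc (toℕ i)) × (toℕ i' ℕ.< toℕ j) ×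
    (lookup σ i' Fin.< lookup σ i) × (lookup σ i Fin.< lookup σ j)

Avoids12-3 : ∀ {k n} → Word k n → Set
Avoids12-3 σ = ¬ Contains12-3 σ

Avoids21-3 : ∀ {k n} → Word k n → Set
Avoids21-3 σ = ¬ Contains21-3 σ

contains12-3? : ∀ {k n} (σ : Word k n) → Dec (Contains12-3 σ)
contains12-3? σ = any? λ i → any? λ i' → any? λ j →
  (toℕ i' ℕP.≟ suc (toℕ i)) ×-dec (toℕ i' ℕP.<? toℕ j) ×-dec
  (lookup σ i FinP.<? lookup σ i') ×-dec (lookup σ i' FinP.<? lookup σ j)

contains21-3? : ∀ {k n} (σ : Word k n) → Dec (Contains21-3 σ)
contains21-3? σ = any? λ i → any? λ i' → any? λ j →
  (toℕ i' ℕP.≟ suc (toℕ i)) ×-dec (toℕ i' ℕP.<? toℕ j) ×-dec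
  (lookup σ i' FinP.<? lookup σ i) ×-dec (lookup σ i FinP.<? lookup σ j)

count12-3 : ℕ → ℕ → ℕ
count12-3 k n = length (filter (λ σ → ¬? (contains12-3? σ)) (allWords k n))

count21-3 : ℕ → ℕ → ℕ
count21-3 k n = length (filter (λ σ → ¬? (contains21-3? σ)) (allWords k n))

-- Formal power series in x with coefficients in ℕ (all series below have
-- nonnegative coefficients), represented by their coefficient sequence.

PS : Set
PS = ℕ → ℕ

sumTo : ℕ → (ℕ → ℕ) → ℕ
sumTo n f = sum (map f (upTo (suc n)))

onePS : PS
onePS zero    = 1
onePS (suc _) = 0

_⊛_ : PS → PS → PS
(f ⊛ g) n = sumTo n (λ i → f i * g (n ∸ i))

_^PS_ : PS → ℕ → PS
f ^PS zero  = onePS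
f ^PS suc m = f ⊛ (f ^PS m)

xPS : PS
xPS zero          = 0
xPS (suc zero)    = 1
xPS (suc (suc _)) = 0

invOneMinusX : PS
invOneMinusX _ = 1

-- 1/(1 - f) = Σ_{m ≥ 0} f^m, for f with zero constant term
-- (then f^m contributes only to degrees ≥ m, so the n-th coefficient
-- is the finite sum Σ_{m=0}^{n} [x^n] f^m).
geomPS : PS → PS
geomPS f n = sumTo n (λ m → (f ^PS m) n)

xOver1-x^ : ℕ → PS
xOver1-x^ j = xPS ⊛ (invOneMinusX ^PS j)

productFormula : ℕ → PS
productFormula k = foldr (λ j acc → geomPS (xOver1-x^ j) ⊛ acc) onePS (upTo k)

-- Let E_m be the generating function of the words over {0,…,m−1} avoiding 12-3.  A word over
-- {0,…,β} avoiding 12-3 that contains β splits uniquely as u β v, where v is any such avoider and u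
-- is a weakly decreasing word over {0,…,β−1}: an ascent in u would be followed by β.  Weakly
-- decreasing words over β letters are counted by 1/(1−x)^β, hence E_{β+1} = E_β + x/(1−x)^β · E_{β+1},
-- that is E_{β+1} = E_β / (1 − x/(1−x)^β), and E_0 = 1.  For 21-3 the same holds with u weakly
-- increasing, so both patterns are counted by the same product.

module Submission where

open import Defs
import Data.Nat.Properties as ℕ
open import Algebra.Properties.CommutativeSemigroup ℕ.+-commutativeSemigroup using (interchange)
open import Algebra.Properties.Semiring.Sum ℕ.+-*-semiring
  using (sum-syntax; sum-cong-≗; ∑-distrib-+; *-distribˡ-sum; ∑-permute; sum-replicate-zero)
open import Data.Bool using (Bool; true; false; if_then_else_)
open import Data.Empty using (⊥; ⊥-elim)
open import Data.Fin as Fin using (Fin; toℕ; opposite)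
open import Data.Fin.Permutation using (_⟨$⟩ʳ_) renaming (reverse to reversal)
open import Data.Fin.Properties using (toℕ<n; opposite-prop; any?)
open import Data.List using (List; []; _∷_; [_]; _++_; map; foldr; upTo; applyUpTo; length; filter; concatMap; tabulate)
open import Data.List.Properties
  using (map-cong; map-upTo; map-applyUpTo; foldr-∷ʳ; upTo-∷ʳ; map-++; length-++; filter-++; filter-≐; filter-none)
import Data.List.Relation.Unary.All as ListAll
open import Data.Nat using (ℕ; zero; suc; _+_; _*_; _∸_; _≤_; _<_; z≤n; s≤s; _≟_; _<?_; _≤?_)
open import Data.Nat.Induction using (<-rec)
open import Data.Nat.ListAction using (sum)
open import Data.Nat.ListAction.Properties using (sum-++)
open import Data.Nat.Solver using (module +-*-Solver)
open import Data.Product using (_×_; _,_; ∃; proj₁; proj₂)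
import Data.Product as Product
open import Data.Sum using (_⊎_; inj₁; inj₂; [_,_]′)
import Data.Sum as Sum
open import Data.Unit using (⊤; tt)
open import Data.Vec using ([]; _∷_; lookup)
open import Data.Vec.Relation.Unary.All using (All; []; _∷_; all?)
import Data.Vec.Relation.Unary.All as All
open import Data.Vec.Relation.Unary.All.Properties using (lookup⁺)
open import Data.Vec.Relation.Unary.Any using (Any; here; there; index)
import Data.Vec.Relation.Unary.Any as Any
open import Data.Vec.Relation.Unary.Any.Properties using (lookup-index)
open import Function using (_∘_; _$_; id)
open import Function.Bundles using (Equivalence; _⇔_; mk⇔)
open import Relation.Binary.Definitions using () renaming (Decidable to Decidable₂)
open import Relation.Binary.PropositionalEquality hiding ([_])
open import Relation.Nullary using (¬_; Dec; yes; no; does)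
open import Relation.Nullary.Decidable using (_×-dec_; _⊎-dec_; ¬?)
open import Relation.Unary using (Decidable; _≐_)

-- Finite sums

sum-applyUpTo : ∀ (f g : ℕ → ℕ) m → sum (map f (applyUpTo g m)) ≡ ∑[ i < m ] f (g (toℕ i))
sum-applyUpTo f g zero    = refl
sum-applyUpTo f g (suc m) = cong (f (g 0) +_) (sum-applyUpTo f (λ i → g (suc i)) m)

sumTo-∑ : ∀ n f → sumTo n f ≡ ∑[ i < suc n ] f (toℕ i)
sumTo-∑ n f = sum-applyUpTo f (λ i → i) (suc n)

sumTo-distrib-+ : ∀ n f g → sumTo n (λ i → f i + g i) ≡ sumTo n f + sumTo n g
sumTo-distrib-+ n f g = begin
  sumTo n (λ i → f i + g i)                                 ≡⟨ sumTo-∑ n (λ i → f i + g i) ⟩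
  (∑[ i < suc n ] (f (toℕ i) + g (toℕ i)))                   ≡⟨ ∑-distrib-+ {suc n} (f ∘ toℕ) (g ∘ toℕ) ⟩
  (∑[ i < suc n ] f (toℕ i)) + (∑[ i < suc n ] g (toℕ i))     ≡⟨ cong₂ _+_ (sumTo-∑ n f) (sumTo-∑ n g) ⟨
  sumTo n f + sumTo n g                                     ∎
  where open ≡-Reasoning

sumTo-distribˡ-* : ∀ n c f → sumTo n (λ i → c * f i) ≡ c * sumTo n f
sumTo-distribˡ-* n c f = begin
  sumTo n (λ i → c * f i)             ≡⟨ sumTo-∑ n (λ i → c * f i) ⟩
  (∑[ i < suc n ] (c * f (toℕ i)))     ≡⟨ *-distribˡ-sum {suc n} c (f ∘ toℕ) ⟨
  c * (∑[ i < suc n ] f (toℕ i))       ≡⟨ cong (c *_) (sumTo-∑ n f) ⟨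
  c * sumTo n f                       ∎
  where open ≡-Reasoning

sum-upTo-suc : ∀ (g : ℕ → ℕ) N → sum (map g (upTo (suc N))) ≡ sum (map g (upTo N)) + g N
sum-upTo-suc g N = begin
  sum (map g (upTo (suc N)))          ≡⟨ cong (sum ∘ map g) (upTo-∷ʳ N) ⟨
  sum (map g (upTo N ++ [ N ]))       ≡⟨ cong sum (map-++ g (upTo N) [ N ]) ⟩
  sum (map g (upTo N) ++ [ g N ])     ≡⟨ sum-++ (map g (upTo N)) [ g N ] ⟩
  sum (map g (upTo N)) + (g N + 0)    ≡⟨ cong (sum (map g (upTo N)) +_) (ℕ.+-identityʳ (g N)) ⟩
  sum (map g (upTo N)) + g N          ∎
  where open ≡-Reasoning

-- Formal power series

infixl 6 _⊕_

_⊕_ : PS → PS → PS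
(f ⊕ g) n = f n + g n

_·_ : ℕ → PS → PS
(c · f) n = c * f n

shift : PS → PS
shift f n = f (suc n)

⊛-at-0 : ∀ f g → (f ⊛ g) 0 ≡ f 0 * g 0
⊛-at-0 f g = ℕ.+-identityʳ _

⊛-at-suc : ∀ f g n → (f ⊛ g) (suc n) ≡ f 0 * g (suc n) + (shift f ⊛ g) n
⊛-at-suc f g n = cong (f 0 * g (suc n) +_) (cong sum (begin
    map h (applyUpTo suc (suc n))  ≡⟨ map-applyUpTo suc h (suc n) ⟩
    applyUpTo (λ i → h (suc i)) (suc n)  ≡⟨ map-upTo (λ i → h (suc i)) (suc n) ⟨
    map (λ i → h (suc i)) (upTo (suc n))  ∎))
  where
  open ≡-Reasoning
  h : ℕ → ℕ
  h i = f i * g (suc n ∸ i)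

⊛-congˡ : ∀ {f f′} g → f ≗ f′ → f ⊛ g ≗ f′ ⊛ g
⊛-congˡ g f≗f′ n = cong sum (map-cong (λ i → cong (_* g (n ∸ i)) (f≗f′ i)) (upTo (suc n)))

⊛-congʳ : ∀ f {g g′} → g ≗ g′ → f ⊛ g ≗ f ⊛ g′
⊛-congʳ f g≗g′ n = cong sum (map-cong (λ i → cong (f i *_) (g≗g′ (n ∸ i))) (upTo (suc n)))

⊛-comm : ∀ f g → f ⊛ g ≗ g ⊛ f
⊛-comm f g n = begin
  (f ⊛ g) n
    ≡⟨ sumTo-∑ n (λ i → f i * g (n ∸ i)) ⟩
  (∑[ i < suc n ] (f (toℕ i) * g (n ∸ toℕ i)))
    ≡⟨ ∑-permute (λ i → f (toℕ i) * g (n ∸ toℕ i)) reversal ⟩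
  (∑[ i < suc n ] (f (toℕ (opposite i)) * g (n ∸ toℕ (opposite i))))
    ≡⟨ sum-cong-≗ reflect ⟩
  (∑[ i < suc n ] (g (toℕ i) * f (n ∸ toℕ i)))
    ≡⟨ sumTo-∑ n (λ i → g i * f (n ∸ i)) ⟨
  (g ⊛ f) n
    ∎
  where
  open ≡-Reasoning
  reflect : ∀ (i : Fin (suc n)) →
            f (toℕ (opposite i)) * g (n ∸ toℕ (opposite i)) ≡ g (toℕ i) * f (n ∸ toℕ i)
  reflect i rewrite opposite-prop i | ℕ.m∸[m∸n]≡n (ℕ.≤-pred (toℕ<n i)) =
    ℕ.*-comm (f (n ∸ toℕ i)) (g (toℕ i))

⊛-distribʳ-⊕ : ∀ f g h → (f ⊕ g) ⊛ h ≗ f ⊛ h ⊕ g ⊛ h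
⊛-distribʳ-⊕ f g h n = trans
  (cong sum (map-cong (λ i → ℕ.*-distribʳ-+ (h (n ∸ i)) (f i) (g i)) (upTo (suc n))))
  (sumTo-distrib-+ n (λ i → f i * h (n ∸ i)) (λ i → g i * h (n ∸ i)))

⊛-distribˡ-⊕ : ∀ f g h → f ⊛ (g ⊕ h) ≗ f ⊛ g ⊕ f ⊛ h
⊛-distribˡ-⊕ f g h n = begin
  (f ⊛ (g ⊕ h)) n          ≡⟨ ⊛-comm f (g ⊕ h) n ⟩
  ((g ⊕ h) ⊛ f) n          ≡⟨ ⊛-distribʳ-⊕ g h f n ⟩
  (g ⊛ f) n + (h ⊛ f) n    ≡⟨ cong₂ _+_ (⊛-comm g f n) (⊛-comm h f n) ⟩
  (f ⊛ g) n + (f ⊛ h) n    ∎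
  where open ≡-Reasoning

·-⊛ : ∀ c f g → (c · f) ⊛ g ≗ c · (f ⊛ g)
·-⊛ c f g n = trans
  (cong sum (map-cong (λ i → ℕ.*-assoc c (f i) (g (n ∸ i))) (upTo (suc n))))
  (sumTo-distribˡ-* n c (λ i → f i * g (n ∸ i)))

⊛-assoc : ∀ f g h → (f ⊛ g) ⊛ h ≗ f ⊛ (g ⊛ h)
⊛-assoc f g h zero = begin
  ((f ⊛ g) ⊛ h) 0        ≡⟨ ⊛-at-0 (f ⊛ g) h ⟩
  (f ⊛ g) 0 * h 0        ≡⟨ cong (_* h 0) (⊛-at-0 f g) ⟩
  f 0 * g 0 * h 0        ≡⟨ ℕ.*-assoc (f 0) (g 0) (h 0) ⟩
  f 0 * (g 0 * h 0)      ≡⟨ cong (f 0 *_) (⊛-at-0 g h) ⟨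
  f 0 * (g ⊛ h) 0        ≡⟨ ⊛-at-0 f (g ⊛ h) ⟨
  (f ⊛ (g ⊛ h)) 0        ∎
  where open ≡-Reasoning
⊛-assoc f g h (suc n) = begin
  ((f ⊛ g) ⊛ h) (suc n)
    ≡⟨ ⊛-at-suc (f ⊛ g) h n ⟩
  (f ⊛ g) 0 * h (suc n) + (shift (f ⊛ g) ⊛ h) n
    ≡⟨ cong₂ (λ a b → a * h (suc n) + b) (⊛-at-0 f g)
             (trans (⊛-congˡ h (⊛-at-suc f g) n) (⊛-distribʳ-⊕ (f 0 · shift g) (shift f ⊛ g) h n)) ⟩
  f 0 * g 0 * h (suc n) + (((f 0 · shift g) ⊛ h) n + ((shift f ⊛ g) ⊛ h) n)
    ≡⟨ cong₂ (λ a b → f 0 * g 0 * h (suc n) + (a + b)) (·-⊛ (f 0) (shift g) h n) (⊛-assoc (shift f) g h n) ⟩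
  f 0 * g 0 * h (suc n) + (f 0 * (shift g ⊛ h) n + (shift f ⊛ (g ⊛ h)) n)
    ≡⟨ solve 5 (λ a b c d e → a :* b :* c :+ (a :* d :+ e) := a :* (b :* c :+ d) :+ e) refl
         (f 0) (g 0) (h (suc n)) ((shift g ⊛ h) n) ((shift f ⊛ (g ⊛ h)) n) ⟩
  f 0 * (g 0 * h (suc n) + (shift g ⊛ h) n) + (shift f ⊛ (g ⊛ h)) n
    ≡⟨ cong (λ a → f 0 * a + (shift f ⊛ (g ⊛ h)) n) (⊛-at-suc g h n) ⟨
  f 0 * (g ⊛ h) (suc n) + (shift f ⊛ (g ⊛ h)) n
    ≡⟨ ⊛-at-suc f (g ⊛ h) n ⟨
  (f ⊛ (g ⊛ h)) (suc n)
    ∎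
  where
  open ≡-Reasoning
  open +-*-Solver

zeroPS : PS
zeroPS _ = 0

zeroPS-⊛ : ∀ f → zeroPS ⊛ f ≗ zeroPS
zeroPS-⊛ f n = trans (sumTo-∑ n (λ _ → 0)) (sum-replicate-zero (suc n))

⊛-identityˡ : ∀ f → onePS ⊛ f ≗ f
⊛-identityˡ f zero    = trans (⊛-at-0 onePS f) (ℕ.*-identityˡ (f 0))
⊛-identityˡ f (suc n) = begin
  (onePS ⊛ f) (suc n)                   ≡⟨ ⊛-at-suc onePS f n ⟩
  1 * f (suc n) + (zeroPS ⊛ f) n        ≡⟨ cong₂ _+_ (ℕ.*-identityˡ (f (suc n))) (zeroPS-⊛ f n) ⟩
  f (suc n) + 0                         ≡⟨ ℕ.+-identityʳ (f (suc n)) ⟩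
  f (suc n)                             ∎
  where open ≡-Reasoning

⊛-identityʳ : ∀ f → f ⊛ onePS ≗ f
⊛-identityʳ f n = trans (⊛-comm f onePS n) (⊛-identityˡ f n)

xPS-⊛-at-suc : ∀ f n → (xPS ⊛ f) (suc n) ≡ f n
xPS-⊛-at-suc f n = trans (⊛-at-suc xPS f n) (trans (⊛-congˡ f shift-x n) (⊛-identityˡ f n))
  where
  shift-x : shift xPS ≗ onePS
  shift-x zero    = refl
  shift-x (suc _) = refl

invOneMinusX-⊛-at-0 : ∀ f → (invOneMinusX ⊛ f) 0 ≡ f 0
invOneMinusX-⊛-at-0 f = trans (⊛-at-0 invOneMinusX f) (ℕ.*-identityˡ (f 0))

invOneMinusX-⊛-at-suc : ∀ f n → (invOneMinusX ⊛ f) (suc n) ≡ f (suc n) + (invOneMinusX ⊛ f) n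
invOneMinusX-⊛-at-suc f n = trans (⊛-at-suc invOneMinusX f n) (cong (_+ (invOneMinusX ⊛ f) n) (ℕ.*-identityˡ (f (suc n))))

⊛-local : ∀ f {g h} n → (∀ d → d ≤ n → g d ≡ h d) → (f ⊛ g) n ≡ (f ⊛ h) n
⊛-local f n g≡h = cong sum (map-cong (λ i → cong (f i *_) (g≡h (n ∸ i) (ℕ.m∸n≤m n i))) (upTo (suc n)))

⊛-local-below : ∀ f {g h} n → f 0 ≡ 0 → (∀ d → d < n → g d ≡ h d) → (f ⊛ g) n ≡ (f ⊛ h) n
⊛-local-below f {g} {h} zero f0≡0 _ = begin
  (f ⊛ g) 0    ≡⟨ ⊛-at-0 f g ⟩
  f 0 * g 0    ≡⟨ cong (_* g 0) f0≡0 ⟩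
  0            ≡⟨ cong (_* h 0) f0≡0 ⟨
  f 0 * h 0    ≡⟨ ⊛-at-0 f h ⟨
  (f ⊛ h) 0    ∎
  where open ≡-Reasoning
⊛-local-below f {g} {h} (suc n) f0≡0 g≡h = begin
  (f ⊛ g) (suc n)                          ≡⟨ ⊛-at-suc f g n ⟩
  f 0 * g (suc n) + (shift f ⊛ g) n        ≡⟨ cong₂ _+_ (cong (_* g (suc n)) f0≡0)
                                                      (⊛-local (shift f) n (λ d d≤n → g≡h d (s≤s d≤n))) ⟩
  0 + (shift f ⊛ h) n                      ≡⟨ cong (λ a → a * h (suc n) + (shift f ⊛ h) n) f0≡0 ⟨
  f 0 * h (suc n) + (shift f ⊛ h) n        ≡⟨ ⊛-at-suc f h n ⟨
  (f ⊛ h) (suc n)                          ∎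
  where open ≡-Reasoning

^PS-vanishes : ∀ {f} → f 0 ≡ 0 → ∀ m d → d < m → (f ^PS m) d ≡ 0
^PS-vanishes {f} f0≡0 (suc m) d d<1+m = begin
  (f ⊛ (f ^PS m)) d    ≡⟨ ⊛-local-below f d f0≡0 below-d ⟩
  (f ⊛ zeroPS) d       ≡⟨ ⊛-comm f zeroPS d ⟩
  (zeroPS ⊛ f) d       ≡⟨ zeroPS-⊛ f d ⟩
  0                    ∎
  where
  open ≡-Reasoning
  below-d : ∀ e → e < d → (f ^PS m) e ≡ 0
  below-d e e<d = ^PS-vanishes f0≡0 m e (ℕ.<-≤-trans e<d (ℕ.≤-pred d<1+m))

-- geomPS f n is geomBelow (suc n) f n.
geomBelow : ℕ → PS → PS
geomBelow N f n = sum (map (λ m → (f ^PS m) n) (upTo N))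

geomBelow-suc : ∀ N f → geomBelow (suc N) f ≗ onePS ⊕ f ⊛ geomBelow N f
geomBelow-suc zero f n = cong (onePS n +_) (sym (trans (⊛-comm f zeroPS n) (zeroPS-⊛ f n)))
geomBelow-suc (suc N) f n = begin
  geomBelow (suc (suc N)) f n
    ≡⟨ sum-upTo-suc (λ m → (f ^PS m) n) (suc N) ⟩
  geomBelow (suc N) f n + (f ⊛ (f ^PS N)) n
    ≡⟨ cong (_+ (f ⊛ (f ^PS N)) n) (geomBelow-suc N f n) ⟩
  onePS n + (f ⊛ geomBelow N f) n + (f ⊛ (f ^PS N)) n
    ≡⟨ ℕ.+-assoc (onePS n) _ _ ⟩
  onePS n + ((f ⊛ geomBelow N f) n + (f ⊛ (f ^PS N)) n)
    ≡⟨ cong (onePS n +_) (⊛-distribˡ-⊕ f (geomBelow N f) (f ^PS N) n) ⟨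
  onePS n + (f ⊛ (geomBelow N f ⊕ f ^PS N)) n
    ≡⟨ cong (onePS n +_) (⊛-congʳ f (λ d → sym (sum-upTo-suc (λ m → (f ^PS m) d) N)) n) ⟩
  onePS n + (f ⊛ geomBelow (suc N) f) n
    ∎
  where open ≡-Reasoning

geomBelow-stable : ∀ {f} → f 0 ≡ 0 → ∀ {N d} → d < N → geomBelow N f d ≡ geomPS f d
geomBelow-stable {f} f0≡0 {suc N} {d} d<1+N with ℕ.m<1+n⇒m<n∨m≡n d<1+N
... | inj₂ refl = refl
... | inj₁ d<N  = begin
  geomBelow (suc N) f d          ≡⟨ sum-upTo-suc (λ m → (f ^PS m) d) N ⟩
  geomBelow N f d + (f ^PS N) d  ≡⟨ cong₂ _+_ (geomBelow-stable f0≡0 d<N) (^PS-vanishes f0≡0 N d d<N) ⟩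
  geomPS f d + 0                 ≡⟨ ℕ.+-identityʳ (geomPS f d) ⟩
  geomPS f d                     ∎
  where open ≡-Reasoning

geomPS-fixpoint : ∀ {f} → f 0 ≡ 0 → geomPS f ≗ onePS ⊕ f ⊛ geomPS f
geomPS-fixpoint {f} f0≡0 n = trans (geomBelow-suc n f n)
  (cong (onePS n +_) (⊛-local-below f n f0≡0 (λ d d<n → geomBelow-stable f0≡0 d<n)))

linear-unique : ∀ {f a g h} → f 0 ≡ 0 → g ≗ a ⊕ f ⊛ g → h ≗ a ⊕ f ⊛ h → g ≗ h
linear-unique {f} {a} {g} {h} f0≡0 g-eq h-eq = <-rec (λ n → g n ≡ h n) λ n g≡h-below →
  trans (g-eq n) (trans (cong (a n +_) (⊛-local-below f n f0≡0 (λ d d<n → g≡h-below d<n))) (sym (h-eq n)))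

linear-solution : ∀ {f a g} → f 0 ≡ 0 → g ≗ a ⊕ f ⊛ g → g ≗ geomPS f ⊛ a
linear-solution {f} {a} f0≡0 g-eq = linear-unique {f} {a} f0≡0 g-eq λ n → begin
  (geomPS f ⊛ a) n                            ≡⟨ ⊛-congˡ a (geomPS-fixpoint f0≡0) n ⟩
  ((onePS ⊕ f ⊛ geomPS f) ⊛ a) n              ≡⟨ ⊛-distribʳ-⊕ onePS (f ⊛ geomPS f) a n ⟩
  (onePS ⊛ a) n + ((f ⊛ geomPS f) ⊛ a) n      ≡⟨ cong₂ _+_ (⊛-identityˡ a n) (⊛-assoc f (geomPS f) a n) ⟩
  a n + (f ⊛ (geomPS f ⊛ a)) n                ∎
  where open ≡-Reasoning

foldr-⊛ : ∀ (F : ℕ → PS) b js → foldr (λ j p → F j ⊛ p) b js ≗ foldr (λ j p → F j ⊛ p) onePS js ⊛ b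
foldr-⊛ F b []       n = sym (⊛-identityˡ b n)
foldr-⊛ F b (j ∷ js) n = trans (⊛-congʳ (F j) (foldr-⊛ F b js) n) (sym (⊛-assoc (F j) _ b n))

productFormula-suc : ∀ k → productFormula (suc k) ≗ productFormula k ⊛ geomPS (xOver1-x^ k)
productFormula-suc k n = begin
  productFormula (suc k) n
    ≡⟨ cong (λ js → foldr factor onePS js n) (upTo-∷ʳ k) ⟨
  foldr factor onePS (upTo k ++ [ k ]) n
    ≡⟨ cong (_$ n) (foldr-∷ʳ factor onePS k (upTo k)) ⟩
  foldr factor (factor k onePS) (upTo k) n
    ≡⟨ foldr-⊛ (geomPS ∘ xOver1-x^) (factor k onePS) (upTo k) n ⟩
  (productFormula k ⊛ (geomPS (xOver1-x^ k) ⊛ onePS)) n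
    ≡⟨ ⊛-congʳ (productFormula k) (⊛-identityʳ (geomPS (xOver1-x^ k))) n ⟩
  (productFormula k ⊛ geomPS (xOver1-x^ k)) n
    ∎
  where
  open ≡-Reasoning
  factor : ℕ → PS → PS
  factor j p = geomPS (xOver1-x^ j) ⊛ p

productFormula-by-recurrence : ∀ (E : ℕ → PS) K → E 0 ≗ onePS →
  (∀ β → β < K → E (suc β) ≗ E β ⊕ xOver1-x^ β ⊛ E (suc β)) →
  ∀ m → m ≤ K → E m ≗ productFormula m
productFormula-by-recurrence E K E0 E-rec zero    _     = E0
productFormula-by-recurrence E K E0 E-rec (suc β) 1+β≤K n = begin
  E (suc β) n
    ≡⟨ linear-solution refl (E-rec β 1+β≤K) n ⟩
  (geomPS (xOver1-x^ β) ⊛ E β) n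
    ≡⟨ ⊛-congʳ (geomPS (xOver1-x^ β)) (productFormula-by-recurrence E K E0 E-rec β (ℕ.<⇒≤ 1+β≤K)) n ⟩
  (geomPS (xOver1-x^ β) ⊛ productFormula β) n
    ≡⟨ ⊛-comm (geomPS (xOver1-x^ β)) (productFormula β) n ⟩
  (productFormula β ⊛ geomPS (xOver1-x^ β)) n
    ≡⟨ productFormula-suc β n ⟨
  productFormula (suc β) n
    ∎
  where open ≡-Reasoning

xOver1-x^-recurrence : ∀ (e : PS) (V : ℕ → PS) β →
  (∀ c → V c 0 ≡ 0) → (∀ n → V 0 (suc n) ≡ e n) →
  (∀ c n → c < β → V (suc c) (suc n) ≡ V c (suc n) + V (suc c) n) →
  V β ≗ xOver1-x^ β ⊛ e
xOver1-x^-recurrence e V β V-at-0 V₀-at-suc V-step zero = V-at-0 β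
xOver1-x^-recurrence e V β V-at-0 V₀-at-suc V-step (suc n) = begin
  V β (suc n)                                  ≡⟨ V-shifted β ℕ.≤-refl n ⟩
  ((invOneMinusX ^PS β) ⊛ e) n                 ≡⟨ xPS-⊛-at-suc ((invOneMinusX ^PS β) ⊛ e) n ⟨
  (xPS ⊛ ((invOneMinusX ^PS β) ⊛ e)) (suc n)   ≡⟨ ⊛-assoc xPS (invOneMinusX ^PS β) e (suc n) ⟨
  (xOver1-x^ β ⊛ e) (suc n)                    ∎
  where
  open ≡-Reasoning
  V-shifted : ∀ c → c ≤ β → ∀ n → V c (suc n) ≡ ((invOneMinusX ^PS c) ⊛ e) n
  V-shifted zero    _     n = trans (V₀-at-suc n) (sym (⊛-identityˡ e n))
  V-shifted (suc c) 1+c≤β n = trans (partial-sums n) (sym (⊛-assoc invOneMinusX (invOneMinusX ^PS c) e n))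
    where
    partial-sums : ∀ n → V (suc c) (suc n) ≡ (invOneMinusX ⊛ ((invOneMinusX ^PS c) ⊛ e)) n
    partial-sums zero = begin
      V (suc c) 1                               ≡⟨ V-step c 0 1+c≤β ⟩
      V c 1 + V (suc c) 0                       ≡⟨ cong₂ _+_ (V-shifted c (ℕ.<⇒≤ 1+c≤β) 0) (V-at-0 (suc c)) ⟩
      ((invOneMinusX ^PS c) ⊛ e) 0 + 0          ≡⟨ ℕ.+-identityʳ _ ⟩
      ((invOneMinusX ^PS c) ⊛ e) 0              ≡⟨ invOneMinusX-⊛-at-0 ((invOneMinusX ^PS c) ⊛ e) ⟨
      (invOneMinusX ⊛ ((invOneMinusX ^PS c) ⊛ e)) 0  ∎
    partial-sums (suc n) = begin
      V (suc c) (suc (suc n))                   ≡⟨ V-step c (suc n) 1+c≤β ⟩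
      V c (suc (suc n)) + V (suc c) (suc n)     ≡⟨ cong₂ _+_ (V-shifted c (ℕ.<⇒≤ 1+c≤β) (suc n)) (partial-sums n) ⟩
      ((invOneMinusX ^PS c) ⊛ e) (suc n) + (invOneMinusX ⊛ ((invOneMinusX ^PS c) ⊛ e)) n
                                                ≡⟨ invOneMinusX-⊛-at-suc ((invOneMinusX ^PS c) ⊛ e) n ⟨
      (invOneMinusX ⊛ ((invOneMinusX ^PS c) ⊛ e)) (suc n)  ∎

-- Counting words by their first letter

ind : Bool → ℕ → ℕ
ind b v = if b then v else 0

ind-split : ∀ {P Q R : Set} (p? : Dec P) (q? : Dec Q) (r? : Dec R) → P ⇔ (Q ⊎ R) → (Q → ¬ R) →
            ∀ v → ind (does p?) v ≡ ind (does q?) v + ind (does r?) v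
ind-split (yes _) (yes q) (yes r) _   disjoint _ = ⊥-elim (disjoint q r)
ind-split (yes _) (yes _) (no _)  _   _        v = sym (ℕ.+-identityʳ v)
ind-split (yes _) (no _)  (yes _) _   _        _ = refl
ind-split (yes p) (no ¬q) (no ¬r) P⇔Q⊎R _      _ = ⊥-elim ([ ¬q , ¬r ]′ (Equivalence.to P⇔Q⊎R p))
ind-split (no ¬p) (yes q) _       P⇔Q⊎R _      _ = ⊥-elim (¬p (Equivalence.from P⇔Q⊎R (inj₁ q)))
ind-split (no ¬p) (no _)  (yes r) P⇔Q⊎R _      _ = ⊥-elim (¬p (Equivalence.from P⇔Q⊎R (inj₂ r)))
ind-split (no _)  (no _)  (no _)  _   _        _ = refl

ind-no : ∀ {P : Set} (p? : Dec P) → ¬ P → ∀ v → ind (does p?) v ≡ 0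
ind-no (yes p) ¬p _ = ⊥-elim (¬p p)
ind-no (no _)  _  _ = refl

∑-pick : ∀ {K} c → c < K → (F : ℕ → ℕ) → (∑[ a < K ] ind (does (toℕ a ≟ c)) (F (toℕ a))) ≡ F c
∑-pick {suc K} zero    _         F = trans (cong (F 0 +_) (sum-replicate-zero K)) (ℕ.+-identityʳ (F 0))
∑-pick {suc K} (suc c) (s≤s c<K) F = ∑-pick c c<K (F ∘ suc)

length-filter-∷ : ∀ {A : Set} {P : A → Set} (P? : Decidable P) x xs →
                  length (filter P? (x ∷ xs)) ≡ ind (does (P? x)) 1 + length (filter P? xs)
length-filter-∷ P? x xs with does (P? x)
... | true  = refl
... | false = refl

length-filter-⊎ : ∀ {A : Set} {Q R : A → Set} (Q? : Decidable Q) (R? : Decidable R) →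
                  (∀ x → Q x → ¬ R x) → ∀ xs →
                  length (filter (λ x → Q? x ⊎-dec R? x) xs) ≡ length (filter Q? xs) + length (filter R? xs)
length-filter-⊎ Q? R? disjoint [] = refl
length-filter-⊎ Q? R? disjoint (x ∷ xs) = begin
  length (filter Q⊎R? (x ∷ xs))
    ≡⟨ length-filter-∷ Q⊎R? x xs ⟩
  ind (does (Q⊎R? x)) 1 + length (filter Q⊎R? xs)
    ≡⟨ cong₂ _+_ (ind-split (Q⊎R? x) (Q? x) (R? x) (mk⇔ id id) (disjoint x) 1) (length-filter-⊎ Q? R? disjoint xs) ⟩
  (ind (does (Q? x)) 1 + ind (does (R? x)) 1) + (length (filter Q? xs) + length (filter R? xs))
    ≡⟨ interchange (ind (does (Q? x)) 1) (ind (does (R? x)) 1) (length (filter Q? xs)) (length (filter R? xs)) ⟩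
  (ind (does (Q? x)) 1 + length (filter Q? xs)) + (ind (does (R? x)) 1 + length (filter R? xs))
    ≡⟨ cong₂ _+_ (length-filter-∷ Q? x xs) (length-filter-∷ R? x xs) ⟨
  length (filter Q? (x ∷ xs)) + length (filter R? (x ∷ xs))
    ∎
  where
  open ≡-Reasoning
  Q⊎R? = λ x → Q? x ⊎-dec R? x

length-filter-map : ∀ {A B : Set} {P : A → Set} (P? : Decidable P) (g : B → A) xs →
                    length (filter P? (map g xs)) ≡ length (filter (λ x → P? (g x)) xs)
length-filter-map P? g []       = refl
length-filter-map P? g (x ∷ xs) with does (P? (g x))
... | true  = cong suc (length-filter-map P? g xs)
... | false = length-filter-map P? g xs

length-filter-concatMap : ∀ {A B : Set} {P : A → Set} (P? : Decidable P) (g : B → List A) {K} (t : Fin K → B) →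
                          length (filter P? (concatMap g (tabulate t))) ≡ ∑[ i < K ] length (filter P? (g (t i)))
length-filter-concatMap P? g {zero}  t = refl
length-filter-concatMap P? g {suc K} t = begin
  length (filter P? (g (t Fin.zero) ++ rest))
    ≡⟨ cong length (filter-++ P? (g (t Fin.zero)) rest) ⟩
  length (filter P? (g (t Fin.zero)) ++ filter P? rest)
    ≡⟨ length-++ (filter P? (g (t Fin.zero))) ⟩
  length (filter P? (g (t Fin.zero))) + length (filter P? rest)
    ≡⟨ cong (length (filter P? (g (t Fin.zero))) +_) (length-filter-concatMap P? g (t ∘ Fin.suc)) ⟩
  length (filter P? (g (t Fin.zero))) + (∑[ i < K ] length (filter P? (g (t (Fin.suc i)))))
    ∎
  where
  open ≡-Reasoning
  rest = concatMap g (tabulate (t ∘ Fin.suc))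

count : ∀ {K} n {P : Word K n → Set} → Decidable P → ℕ
count {K} n P? = length (filter P? (allWords K n))

count-suc : ∀ {K} n {P : Word K (suc n) → Set} (P? : Decidable P) →
            count (suc n) P? ≡ ∑[ a < K ] count n (λ w → P? (a ∷ w))
count-suc {K} n P? = trans
  (length-filter-concatMap P? (λ a → map (a ∷_) (allWords K n)) id)
  (sum-cong-≗ (λ a → length-filter-map P? (a ∷_) (allWords K n)))

count-≐ : ∀ {K} n {P Q : Word K n → Set} (P? : Decidable P) (Q? : Decidable Q) → P ≐ Q → count n P? ≡ count n Q?
count-≐ {K} n P? Q? P≐Q = cong length (filter-≐ P? Q? P≐Q (allWords K n))

count-none : ∀ {K} n {P : Word K n → Set} (P? : Decidable P) → (∀ w → ¬ P w) → count n P? ≡ 0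
count-none {K} n P? none = cong length (filter-none P? (ListAll.universal none (allWords K n)))

count-⊎ : ∀ {K} n {Q R : Word K n → Set} (Q? : Decidable Q) (R? : Decidable R) → (∀ w → Q w → ¬ R w) →
          count n (λ w → Q? w ⊎-dec R? w) ≡ count n Q? + count n R?
count-⊎ {K} n Q? R? disjoint = length-filter-⊎ Q? R? disjoint (allWords K n)

count-× : ∀ {K} n {P : Set} {Q : Word K n → Set} (p? : Dec P) (Q? : Decidable Q) →
          count n (λ w → p? ×-dec Q? w) ≡ ind (does p?) (count n Q?)
count-× n (yes p) Q? = count-≐ n _ Q? ((λ (_ , q) → q) , (λ q → p , q))
count-× n (no ¬p) Q? = count-none n _ (λ _ (p , _) → ¬p p)

-- Avoiders of a pattern xy-z

infix 25 _!_

_!_ : ∀ {K n} → Word K n → Fin n → ℕ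
σ ! i = toℕ (lookup σ i)

module Pattern
  (_≺_ : ℕ → ℕ → Set) (_≺?_ : Decidable₂ _≺_) (top : ℕ → ℕ → ℕ)
  (top-selects : ∀ a b → top a b ≡ a ⊎ top a b ≡ b)
  (≺-top : ∀ {a b} → a ≺ b → a ≤ top a b × b ≤ top a b)
  where

  -- After a letter a, a chain continues with a letter b such that ¬ a ≺ b.  A ladder orders these
  -- sets of letters, restricted to {0,…,β−1}, as ∅ = Rung 0 ⊂ Rung 1 ⊂ ⋯ ⊂ Rung β = {0,…,β−1}, where
  -- Rung (suc c) adds the letter step c, after which exactly Rung (suc c) is allowed.  Chains that may
  -- start in Rung c are then counted by 1/(1−x)^c.
  record Ladder (β : ℕ) : Set₁ where
    field
      Rung       : ℕ → ℕ → Set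
      rung?      : ∀ c → Decidable (Rung c)
      step       : ℕ → ℕ
      step<β     : ∀ {c} → c < β → step c < β
      rung-0     : ∀ {a} → a < β → ¬ Rung 0 a
      rung-β     : ∀ {a} → a < β → Rung β a
      rung-suc   : ∀ {c a} → c < β → Rung (suc c) a ⇔ (Rung c a ⊎ a ≡ step c)
      step∉rung  : ∀ {c} → c < β → ¬ Rung c (step c)
      after-step : ∀ {c a} → c < β → (¬ step c ≺ a) ⇔ Rung (suc c) a

  module _ {K : ℕ} where

    Occurrence : ∀ {n} → Word K n → Set
    Occurrence {n} σ = ∃ λ (i : Fin n) → ∃ λ (i′ : Fin n) → ∃ λ (j : Fin n) →
      (toℕ i′ ≡ suc (toℕ i)) × (toℕ i′ < toℕ j) × (σ ! i ≺ σ ! i′) × (top (σ ! i) (σ ! i′) < σ ! j)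

    Exceeds : ∀ {n} → ℕ → Word K n → Set
    Exceeds c τ = ∃ λ j → c < τ ! j

    OpensOccurrence : ∀ {n} → Fin K → Word K n → Set
    OpensOccurrence a []      = ⊥
    OpensOccurrence a (b ∷ τ) = (toℕ a ≺ toℕ b) × Exceeds (top (toℕ a) (toℕ b)) τ

    Avoids : ∀ {n} → Word K n → Set
    Avoids []      = ⊤
    Avoids (a ∷ w) = ¬ OpensOccurrence a w × Avoids w

    opens? : ∀ {n} a (w : Word K n) → Dec (OpensOccurrence a w)
    opens? a []      = no λ ()
    opens? a (b ∷ τ) = (toℕ a ≺? toℕ b) ×-dec any? (λ j → top (toℕ a) (toℕ b) <? τ ! j)

    avoids? : ∀ {n} → Decidable (Avoids {n})
    avoids? []      = yes tt
    avoids? (a ∷ w) = ¬? (opens? a w) ×-dec avoids? w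

    opens⇒occurrence : ∀ {n} a (w : Word K n) → OpensOccurrence a w → Occurrence (a ∷ w)
    opens⇒occurrence a (b ∷ τ) (a≺b , j , top<τj) =
      Fin.zero , Fin.suc Fin.zero , Fin.suc (Fin.suc j) , refl , s≤s (s≤s z≤n) , a≺b , top<τj

    occurrence-∷ : ∀ {n} a {w : Word K n} → Occurrence w → Occurrence (a ∷ w)
    occurrence-∷ a (i , i′ , j , i′≡1+i , i′<j , occ) =
      Fin.suc i , Fin.suc i′ , Fin.suc j , cong suc i′≡1+i , s≤s i′<j , occ

    occurrence-uncons : ∀ {n} a (w : Word K n) → Occurrence (a ∷ w) → OpensOccurrence a w ⊎ Occurrence w
    occurrence-uncons a (b ∷ τ) (Fin.zero , Fin.suc Fin.zero , Fin.suc (Fin.suc j) , refl , _ , a≺b , top<τj) =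
      inj₁ (a≺b , j , top<τj)
    occurrence-uncons a (b ∷ τ) (Fin.zero , Fin.suc Fin.zero , Fin.suc Fin.zero , refl , s≤s () , _)
    occurrence-uncons a w (Fin.suc i , Fin.suc i′ , Fin.suc j , i′≡1+i , i′<j , occ) =
      inj₂ (i , i′ , j , ℕ.suc-injective i′≡1+i , ℕ.≤-pred i′<j , occ)

    avoids⇔¬occurrence : ∀ {n} (σ : Word K n) → Avoids σ ⇔ (¬ Occurrence σ)
    avoids⇔¬occurrence σ = mk⇔ (sound σ) (complete σ)
      where
      sound : ∀ {n} (σ : Word K n) → Avoids σ → ¬ Occurrence σ
      sound (a ∷ w) (¬opens , avoids-w) occ with occurrence-uncons a w occ
      ... | inj₁ opens = ¬opens opens
      ... | inj₂ occ-w = sound w avoids-w occ-w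
      complete : ∀ {n} (σ : Word K n) → ¬ Occurrence σ → Avoids σ
      complete []      _    = tt
      complete (a ∷ w) ¬occ = ¬occ ∘ opens⇒occurrence a w , complete w (¬occ ∘ occurrence-∷ a)

    Below : ∀ {n} → ℕ → Word K n → Set
    Below m = All (λ a → toℕ a < m)

    HasLetter : ∀ {n} → ℕ → Word K n → Set
    HasLetter β = Any (λ a → toℕ a ≡ β)

    AvoidsBelow : ∀ {n} → ℕ → Word K n → Set
    AvoidsBelow m w = Avoids w × Below m w

    avoidsBelow? : ∀ {n} m → Decidable (AvoidsBelow {n} m)
    avoidsBelow? m w = avoids? w ×-dec all? (λ a → toℕ a <? m) w

    below-¬exceeds : ∀ {n β c} {τ : Word K n} → Below (suc β) τ → β ≤ c → ¬ Exceeds c τ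
    below-¬exceeds below β≤c (j , c<τj) = ℕ.<⇒≱ c<τj (ℕ.≤-trans (ℕ.≤-pred (lookup⁺ below j)) β≤c)

    hasLetter⇒exceeds : ∀ {n β c} {τ : Word K n} → HasLetter β τ → c < β → Exceeds c τ
    hasLetter⇒exceeds has c<β = index has , subst (_ <_) (sym (lookup-index has)) c<β

    below⇒¬hasLetter : ∀ {n m} {w : Word K n} → Below m w → ¬ HasLetter m w
    below⇒¬hasLetter below has = ℕ.<-irrefl (lookup-index has) (lookup⁺ below (index has))

    below-pred : ∀ {n m} {w : Word K n} → Below (suc m) w → ¬ HasLetter m w → Below m w
    below-pred []              _    = []
    below-pred (a<1+m ∷ below) ¬has = ℕ.≤∧≢⇒< (ℕ.≤-pred a<1+m) (¬has ∘ here) ∷ below-pred below (¬has ∘ there)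

    ¬opens-at-max : ∀ {n β} a b {τ : Word K n} → Below (suc β) τ → toℕ a ≡ β ⊎ toℕ b ≡ β →
                    ¬ OpensOccurrence a (b ∷ τ)
    ¬opens-at-max a b below (inj₁ a≡β) (a≺b , exceeds) =
      below-¬exceeds below (subst (_≤ _) a≡β (proj₁ (≺-top a≺b))) exceeds
    ¬opens-at-max a b below (inj₂ b≡β) (a≺b , exceeds) =
      below-¬exceeds below (subst (_≤ _) b≡β (proj₂ (≺-top a≺b))) exceeds

    -- w = u β v, where u is a word over {0,…,β−1} whose first letter is Allowed and which has no
    -- adjacent pair a ≺ b, and v avoids the pattern over {0,…,β}.
    ChainThenMax : ∀ {n} → ℕ → (ℕ → Set) → Word K n → Set
    ChainThenMax β Allowed []      = ⊥
    ChainThenMax β Allowed (a ∷ w) =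
      (toℕ a ≡ β × AvoidsBelow (suc β) w) ⊎ ((toℕ a < β × Allowed (toℕ a)) × ChainThenMax β (λ b → ¬ toℕ a ≺ b) w)

    chainThenMax? : ∀ {n} β {Allowed : ℕ → Set} → Decidable Allowed → Decidable (ChainThenMax {n} β Allowed)
    chainThenMax? β allowed? []      = no λ ()
    chainThenMax? β allowed? (a ∷ w) =
      (toℕ a ≟ β ×-dec avoidsBelow? (suc β) w)
        ⊎-dec ((toℕ a <? β ×-dec allowed? (toℕ a)) ×-dec chainThenMax? β (λ b → ¬? (toℕ a ≺? b)) w)

    chainThenMax-map : ∀ {n β} {A A′ : ℕ → Set} → (∀ {a} → A a → A′ a) →
                       (w : Word K n) → ChainThenMax β A w → ChainThenMax β A′ w
    chainThenMax-map A⇒A′ (a ∷ w) = Sum.map₂ (Product.map₁ (Product.map₂ A⇒A′))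

    HeadIn : ∀ {n} → ℕ → (ℕ → Set) → Word K n → Set
    HeadIn β Allowed []      = ⊥
    HeadIn β Allowed (b ∷ _) = toℕ b ≡ β ⊎ Allowed (toℕ b)

    ¬opens-before : ∀ {n β} a (w : Word K n) → Below (suc β) w →
                    toℕ a ≡ β ⊎ HeadIn β (λ b → ¬ toℕ a ≺ b) w → ¬ OpensOccurrence a w
    ¬opens-before a (b ∷ τ) (_ ∷ below) (inj₁ a≡β)          = ¬opens-at-max a b below (inj₁ a≡β)
    ¬opens-before a (b ∷ τ) (_ ∷ below) (inj₂ (inj₁ b≡β))   = ¬opens-at-max a b below (inj₂ b≡β)
    ¬opens-before a (b ∷ τ) _           (inj₂ (inj₂ ¬a≺b))  = ¬a≺b ∘ proj₁

    chainThenMax-sound : ∀ {n β Allowed} (w : Word K n) → ChainThenMax β Allowed w →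
                         AvoidsBelow (suc β) w × HasLetter β w × HeadIn β Allowed w
    chainThenMax-sound (a ∷ w) (inj₁ (a≡β , avoids , below)) =
      ((¬opens-before a w below (inj₁ a≡β) , avoids) , s≤s (ℕ.≤-reflexive a≡β) ∷ below) , here a≡β , inj₁ a≡β
    chainThenMax-sound (a ∷ w) (inj₂ ((a<β , allowed) , chain)) with chainThenMax-sound w chain
    ... | (avoids , below) , has , head =
      ((¬opens-before a w below (inj₂ head) , avoids) , ℕ.m<n⇒m<1+n a<β ∷ below) , there has , inj₂ allowed

    top-< : ∀ {a b c} → a < c → b < c → top a b < c
    top-< {a} {b} a<c b<c with top-selects a b
    ... | inj₁ top≡a = subst (_< _) (sym top≡a) a<c
    ... | inj₂ top≡b = subst (_< _) (sym top≡b) b<c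

    -- Before the first β, an adjacent pair a ≺ b of smaller letters would be followed by β.
    ¬≺-before-max : ∀ {n β} a (w : Word K n) → toℕ a < β → Below (suc β) w → HasLetter β w →
                    ¬ OpensOccurrence a w → HeadIn β (λ b → ¬ toℕ a ≺ b) w
    ¬≺-before-max {β = β} a (b ∷ τ) a<β (b<1+β ∷ _) has ¬opens with toℕ b ≟ β | has
    ... | yes b≡β | _          = inj₁ b≡β
    ... | no b≢β  | here b≡β   = ⊥-elim (b≢β b≡β)
    ... | no b≢β  | there has′ =
      inj₂ λ a≺b → ¬opens (a≺b , hasLetter⇒exceeds has′ (top-< a<β (ℕ.≤∧≢⇒< (ℕ.≤-pred b<1+β) b≢β)))

    chainThenMax-complete : ∀ {n β Allowed} (w : Word K n) → AvoidsBelow (suc β) w → HasLetter β w →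
                            HeadIn β Allowed w → ChainThenMax β Allowed w
    chainThenMax-complete {β = β} (a ∷ w) ((¬opens , avoids) , a<1+β ∷ below) has head with toℕ a ≟ β | has | head
    ... | yes a≡β | _         | _            = inj₁ (a≡β , avoids , below)
    ... | no a≢β  | here a≡β  | _            = ⊥-elim (a≢β a≡β)
    ... | no a≢β  | there _   | inj₁ a≡β     = ⊥-elim (a≢β a≡β)
    ... | no a≢β  | there has′ | inj₂ allowed =
      inj₂ ((a<β , allowed) , chainThenMax-complete w (avoids , below) has′ (¬≺-before-max a w a<β below has′ ¬opens))
      where a<β = ℕ.≤∧≢⇒< (ℕ.≤-pred a<1+β) a≢β

    avoiders : ℕ → PS
    avoiders m n = count n (avoidsBelow? m)

    chains : ℕ → {Allowed : ℕ → Set} → Decidable Allowed → PS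
    chains β allowed? n = count n (chainThenMax? β allowed?)

    avoiders-0 : avoiders 0 ≗ onePS
    avoiders-0 zero    = refl
    avoiders-0 (suc n) = count-none (suc n) (avoidsBelow? 0) λ { (_ ∷ _) (_ , () ∷ _) }

    avoiders-split : ∀ β {Allowed} (allowed? : Decidable Allowed) → (∀ {a} → a < β → Allowed a) →
                     ∀ n → avoiders (suc β) n ≡ avoiders β n + chains β allowed? n
    avoiders-split β allowed? all-allowed n = trans
      (count-≐ n (avoidsBelow? (suc β)) (λ w → avoidsBelow? β w ⊎-dec chainThenMax? β allowed? w) (split _ , merge _))
      (count-⊎ n (avoidsBelow? β) (chainThenMax? β allowed?) disjoint)
      where
      head-allowed : ∀ {n} (w : Word K n) → Below (suc β) w → HasLetter β w → HeadIn β _ w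
      head-allowed (b ∷ _) (b<1+β ∷ _) _ = Sum.swap (Sum.map₁ all-allowed (ℕ.m<1+n⇒m<n∨m≡n b<1+β))
      split : ∀ {n} (w : Word K n) → AvoidsBelow (suc β) w → AvoidsBelow β w ⊎ ChainThenMax β _ w
      split w (avoids , below) with Any.any? (λ a → toℕ a ≟ β) w
      ... | yes has = inj₂ (chainThenMax-complete w (avoids , below) has (head-allowed w below has))
      ... | no ¬has = inj₁ (avoids , below-pred below ¬has)
      merge : ∀ {n} (w : Word K n) → AvoidsBelow β w ⊎ ChainThenMax β _ w → AvoidsBelow (suc β) w
      merge w (inj₁ (avoids , below)) = avoids , All.map ℕ.m<n⇒m<1+n below
      merge w (inj₂ chain)            = proj₁ (chainThenMax-sound w chain)
      disjoint : ∀ w → AvoidsBelow β w → ¬ ChainThenMax β _ w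
      disjoint w (_ , below) chain = below⇒¬hasLetter below (proj₁ (proj₂ (chainThenMax-sound w chain)))

    chains-suc : ∀ β → β < K → ∀ {Allowed} (allowed? : Decidable Allowed) n →
                 chains β allowed? (suc n) ≡
                 avoiders (suc β) n +
                 ∑[ a < K ] ind (does (toℕ a <? β ×-dec allowed? (toℕ a))) (chains β (λ b → ¬? (toℕ a ≺? b)) n)
    chains-suc β β<K allowed? n = begin
      chains β allowed? (suc n)
        ≡⟨ count-suc n (chainThenMax? β allowed?) ⟩
      (∑[ a < K ] count n (λ w → chainThenMax? β allowed? (a ∷ w)))
        ≡⟨ sum-cong-≗ by-first-letter ⟩
      (∑[ a < K ] (ind (does (toℕ a ≟ β)) (avoiders (suc β) n) + chained a))
        ≡⟨ ∑-distrib-+ (λ a → ind (does (toℕ a ≟ β)) (avoiders (suc β) n)) chained ⟩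
      (∑[ a < K ] ind (does (toℕ a ≟ β)) (avoiders (suc β) n)) + (∑[ a < K ] chained a)
        ≡⟨ cong (_+ (∑[ a < K ] chained a)) (∑-pick β β<K (λ _ → avoiders (suc β) n)) ⟩
      avoiders (suc β) n + (∑[ a < K ] chained a)
        ∎
      where
      open ≡-Reasoning
      chained : Fin K → ℕ
      chained a = ind (does (toℕ a <? β ×-dec allowed? (toℕ a))) (chains β (λ b → ¬? (toℕ a ≺? b)) n)
      by-first-letter : ∀ a → count n (λ w → chainThenMax? β allowed? (a ∷ w)) ≡
                              ind (does (toℕ a ≟ β)) (avoiders (suc β) n) + chained a
      by-first-letter a = trans
        (count-⊎ n _ _ (λ _ (a≡β , _) ((a<β , _) , _) → ℕ.<-irrefl a≡β a<β))
        (cong₂ _+_ (count-× n (toℕ a ≟ β) (avoidsBelow? (suc β))) (count-× n (toℕ a <? β ×-dec allowed? (toℕ a)) _))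

    chains-cong : ∀ β {A A′ : ℕ → Set} (A? : Decidable A) (A′? : Decidable A′) → (∀ {a} → A a ⇔ A′ a) →
                  chains β A? ≗ chains β A′?
    chains-cong β A? A′? A⇔A′ n = count-≐ n (chainThenMax? β A?) (chainThenMax? β A′?)
      (chainThenMax-map (Equivalence.to A⇔A′) _ , chainThenMax-map (Equivalence.from A⇔A′) _)

    module _ {β} (β<K : β < K) (L : Ladder β) where
      open Ladder L

      chains-rung-0 : ∀ n → chains β (rung? 0) (suc n) ≡ avoiders (suc β) n
      chains-rung-0 n = begin
        chains β (rung? 0) (suc n)
          ≡⟨ chains-suc β β<K (rung? 0) n ⟩
        avoiders (suc β) n + (∑[ a < K ] ind (does (toℕ a <? β ×-dec rung? 0 (toℕ a))) (chains β (λ b → ¬? (toℕ a ≺? b)) n))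
          ≡⟨ cong (avoiders (suc β) n +_) (sum-cong-≗ {K} λ a →
               ind-no (toℕ a <? β ×-dec rung? 0 (toℕ a)) (λ (a<β , r) → rung-0 a<β r) _) ⟩
        avoiders (suc β) n + (∑[ a < K ] 0)
          ≡⟨ cong (avoiders (suc β) n +_) (sum-replicate-zero K) ⟩
        avoiders (suc β) n + 0
          ≡⟨ ℕ.+-identityʳ _ ⟩
        avoiders (suc β) n
          ∎
        where open ≡-Reasoning

      chains-climb : ∀ c n → c < β →
                     chains β (rung? (suc c)) (suc n) ≡ chains β (rung? c) (suc n) + chains β (rung? (suc c)) n
      chains-climb c n c<β = begin
        chains β (rung? (suc c)) (suc n)
          ≡⟨ chains-suc β β<K (rung? (suc c)) n ⟩
        E + (∑[ a < K ] ind (does (below-rung (suc c) a)) (W a))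
          ≡⟨ cong (E +_) (sum-cong-≗ λ a → ind-split (below-rung (suc c) a) (below-rung c a) (toℕ a ≟ step c)
               added (λ (_ , r) e → step∉rung c<β (subst (Rung c) e r)) (W a)) ⟩
        E + (∑[ a < K ] (ind (does (below-rung c a)) (W a) + ind (does (toℕ a ≟ step c)) (W a)))
          ≡⟨ cong (E +_) (∑-distrib-+ (λ a → ind (does (below-rung c a)) (W a))
                                      (λ a → ind (does (toℕ a ≟ step c)) (W a))) ⟩
        E + (S + (∑[ a < K ] ind (does (toℕ a ≟ step c)) (W a)))
          ≡⟨ cong (λ x → E + (S + x)) (∑-pick (step c) (ℕ.<-trans (step<β c<β) β<K) after) ⟩
        E + (S + after (step c))
          ≡⟨ ℕ.+-assoc E S (after (step c)) ⟨
        E + S + after (step c)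
          ≡⟨ cong₂ _+_ (chains-suc β β<K (rung? c) n) (sym (chains-cong β _ (rung? (suc c)) (after-step c<β) n)) ⟨
        chains β (rung? c) (suc n) + chains β (rung? (suc c)) n
          ∎
        where
        open ≡-Reasoning
        below-rung : ∀ c (a : Fin K) → Dec (toℕ a < β × Rung c (toℕ a))
        below-rung c a = toℕ a <? β ×-dec rung? c (toℕ a)
        E = avoiders (suc β) n
        after : ℕ → ℕ
        after a = chains β (λ b → ¬? (a ≺? b)) n
        W : Fin K → ℕ
        W a = after (toℕ a)
        S = ∑[ a < K ] ind (does (below-rung c a)) (W a)
        added : ∀ {a} → (a < β × Rung (suc c) a) ⇔ ((a < β × Rung c a) ⊎ a ≡ step c)
        added = mk⇔
          (λ (a<β , r) → Sum.map₁ (a<β ,_) (Equivalence.to (rung-suc c<β) r))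
          [ (λ (a<β , r) → a<β , Equivalence.from (rung-suc c<β) (inj₁ r))
          , (λ { refl → step<β c<β , Equivalence.from (rung-suc c<β) (inj₂ refl) }) ]′

      chains-gf : chains β (rung? β) ≗ xOver1-x^ β ⊛ avoiders (suc β)
      chains-gf = xOver1-x^-recurrence (avoiders (suc β)) (λ c → chains β (rung? c)) β (λ _ → refl) chains-rung-0 chains-climb

    avoiders-suc : ∀ β → β < K → Ladder β → avoiders (suc β) ≗ avoiders β ⊕ xOver1-x^ β ⊛ avoiders (suc β)
    avoiders-suc β β<K L n = trans
      (avoiders-split β (Ladder.rung? L β) (Ladder.rung-β L) n)
      (cong (avoiders β n +_) (chains-gf β<K L n))

    count-avoiders : (∀ β → Ladder β) → (occurs? : ∀ {n} → Decidable (Occurrence {n})) →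
                     ∀ n → length (filter (λ σ → ¬? (occurs? σ)) (allWords K n)) ≡ productFormula K n
    count-avoiders ladder occurs? n = begin
      count n (λ σ → ¬? (occurs? σ))
        ≡⟨ count-≐ n (λ σ → ¬? (occurs? σ)) (avoidsBelow? K)
             ((λ {σ} ¬occ → Equivalence.from (avoids⇔¬occurrence σ) ¬occ , All.universal toℕ<n σ)
             , (λ {σ} (avoids , _) → Equivalence.to (avoids⇔¬occurrence σ) avoids)) ⟩
      avoiders K n
        ≡⟨ productFormula-by-recurrence avoiders K avoiders-0 (λ β β<K → avoiders-suc β β<K (ladder β)) K ℕ.≤-refl n ⟩
      productFormula K n
        ∎
      where open ≡-Reasoning

-- The patterns 12-3 and 21-3

-- With these parameters Occurrence is Contains12-3, resp. Contains21-3, up to β-reduction.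
module Ascent  = Pattern _<_ _<?_ (λ _ b → b) (λ _ _ → inj₂ refl) (λ a<b → ℕ.<⇒≤ a<b , ℕ.≤-refl)
module Descent =
  Pattern (λ a b → b < a) (λ a b → b <? a) (λ a _ → a) (λ _ _ → inj₁ refl) (λ b<a → ℕ.≤-refl , ℕ.<⇒≤ b<a)

ascent-ladder : ∀ β → Ascent.Ladder β
ascent-ladder β = record
  { Rung       = λ c a → a < c
  ; rung?      = λ c a → a <? c
  ; step       = id
  ; step<β     = id
  ; rung-0     = λ _ ()
  ; rung-β     = id
  ; rung-suc   = λ _ → mk⇔ ℕ.m<1+n⇒m<n∨m≡n [ ℕ.m<n⇒m<1+n , (λ { refl → ℕ.n<1+n _ }) ]′
  ; step∉rung  = λ _ → ℕ.<-irrefl refl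
  ; after-step = λ _ → mk⇔ (λ c≮a → s≤s (ℕ.≮⇒≥ c≮a)) (λ a<1+c → ℕ.≤⇒≯ (ℕ.≤-pred a<1+c))
  }

descent-ladder : ∀ β → Descent.Ladder β
descent-ladder β = record
  { Rung       = λ c a → β ∸ c ≤ a
  ; rung?      = λ c a → β ∸ c ≤? a
  ; step       = λ c → β ∸ suc c
  ; step<β     = ℕ.∸-monoʳ-< (s≤s z≤n)
  ; rung-0     = λ a<β β≤a → ℕ.<⇒≱ a<β β≤a
  ; rung-β     = λ {a} _ → subst (_≤ a) (sym (ℕ.n∸n≡0 β)) z≤n
  ; rung-suc   = λ {c} {a} c<β → mk⇔
      (λ β∸1+c≤a → Sum.map (subst (_≤ a) (sym (β∸c≡1+β∸1+c c<β))) sym (ℕ.m≤n⇒m<n∨m≡n β∸1+c≤a))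
      [ (λ β∸c≤a → ℕ.≤-trans (ℕ.∸-monoʳ-≤ β (ℕ.n≤1+n _)) β∸c≤a) , (λ { refl → ℕ.≤-refl }) ]′
  ; step∉rung  = λ {c} c<β β∸c≤β∸1+c →
      ℕ.<-irrefl refl (subst (_≤ β ∸ suc c) (β∸c≡1+β∸1+c c<β) β∸c≤β∸1+c)
  ; after-step = λ _ → mk⇔ ℕ.≮⇒≥ (λ β∸1+c≤a → ℕ.≤⇒≯ β∸1+c≤a)
  }
  where
  β∸c≡1+β∸1+c : ∀ {c} → c < β → β ∸ c ≡ suc (β ∸ suc c)
  β∸c≡1+β∸1+c c<β = ℕ.+-∸-assoc 1 c<β

count12-3≡productFormula : ∀ k n → count12-3 k n ≡ productFormula k n
count12-3≡productFormula k = Ascent.count-avoiders ascent-ladder contains12-3?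

count21-3≡productFormula : ∀ k n → count21-3 k n ≡ productFormula k n
count21-3≡productFormula k = Descent.count-avoiders descent-ladder contains21-3?

theorem3p6 : ((k n : ℕ) → count12-3 k n ≡ count21-3 k n)
    × ((k : ℕ) → 1 ≤ k → (n : ℕ) →
        (count12-3 k n ≡ productFormula k n) × (count21-3 k n ≡ productFormula k n))
theorem3p6 =
  (λ k n → trans (count12-3≡productFormula k n) (sym (count21-3≡productFormula k n))) ,
  (λ k _ n → count12-3≡productFormula k n , count21-3≡productFormula k n)
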